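{- Let $t$ be a $\lambda$-term and $\rho: t\to^n u\to_{\tt ls}^k r$ an LSC derivation having the subterm property and whose suffix $u\to_{\tt ls}^k r$ is nested. Then $k\le |u|_{[\,]}$.
   Context: LSC terms: $t::= x\mid \lambda x.t\mid tu\mid t[x\leftarrow u]$ (explicit substitution (ES) binding $x$), modulo $\alpha$; $\lambda$-terms have no ES; $|u|_{[\,]}$ is the number of ES of $u$. Shallow contexts $C::=\langle\cdot\rangle\mid \lambda x.C\mid Ct\mid tC\mid C[x\leftarrow t]$; substitution contexts $L::=\langle\cdot\rangle\mid L[x\leftarrow t]$. Reduction: closure under shallow contexts of ${\tt dB}$: $(L\langle\lambda x.t\rangle)u\to L\langle t[x\leftarrow u]\rangle$ and ${\tt ls}$: $C\langle x\rangle[x\leftarrow u]\to C\langle u\rangle[x\leftarrow u]$ ($C$ not capturing $x$); such an ${\tt ls}$-step duplicates $u$. An ${\tt ls}$-step $D\langle C\langle x\rangle[x\leftarrow u]\rangle\to D\langle C\langle u\rangle[x\leftarrow u]\rangle$ is written compactly $E\langle x\rangle\to E\langle u\rangle$ with $E=D\langle C[x\leftarrow u]\rangle$. A derivation from $t$ has the subterm property if every term duplicated by one of its ${\tt ls}$-steps is a subterm of $t$. Two consecutive ${\tt ls}$-steps are nested if there are $C,D$ such that they read, in compact form, $C\langle x\rangle\to C\langle D\langle y\rangle\rangle\to C\langle D\langle u'\rangle\rangle$; a derivation is nested if any two consecutive ${\tt ls}$-steps of it are nested. -}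

module Defs where

open import Data.Nat using (ℕ; zero; suc; _+_)
open import Data.Fin using (Fin; zero; suc)
open import Data.Product using (Σ; _×_; _,_)
open import Data.Unit using (⊤)
open import Function using (_∘_; id)
open import Function.Definitions using (Injective)
open import Relation.Binary.PropositionalEquality using (_≡_)

-- LSC terms, intrinsically scoped de Bruijn syntax (α-equivalence is
-- syntactic equality).  A term of type Tm n has free variables in Fin n.
--   es t u  represents  t[x←u]  where x is the variable 0 of t.

data Tm (n : ℕ) : Set where
  var : Fin n → Tm n
  lam : Tm (suc n) → Tm n
  app : Tm n → Tm n → Tm n
  es  : Tm (suc n) → Tm n → Tm n

lift : ∀ {n m} → (Fin n → Fin m) → Fin (suc n) → Fin (suc m)
lift ρ zero    = zero
lift ρ (suc i) = suc (ρ i)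

rename : ∀ {n m} → (Fin n → Fin m) → Tm n → Tm m
rename ρ (var x)   = var (ρ x)
rename ρ (lam t)   = lam (rename (lift ρ) t)
rename ρ (app t u) = app (rename ρ t) (rename ρ u)
rename ρ (es t u)  = es (rename (lift ρ) t) (rename ρ u)

esCount : ∀ {n} → Tm n → ℕ
esCount (var x)   = 0
esCount (lam t)   = esCount t
esCount (app t u) = esCount t + esCount u
esCount (es t u)  = suc (esCount t + esCount u)

data IsLambda {n : ℕ} : Tm n → Set where
  var : ∀ x → IsLambda (var x)
  lam : ∀ {t} → IsLambda t → IsLambda (lam t)
  app : ∀ {t u} → IsLambda t → IsLambda u → IsLambda (app t u)

-- Shallow contexts  C ::= ⟨·⟩ | λx.C | C t | t C | C[x←t]
-- Ctx n m : the whole term lives in scope n, the hole in scope m.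

data Ctx : ℕ → ℕ → Set where
  hole : ∀ {n} → Ctx n n
  lamC : ∀ {n m} → Ctx (suc n) m → Ctx n m
  appL : ∀ {n m} → Ctx n m → Tm n → Ctx n m
  appR : ∀ {n m} → Tm n → Ctx n m → Ctx n m
  esL  : ∀ {n m} → Ctx (suc n) m → Tm n → Ctx n m

plug : ∀ {n m} → Ctx n m → Tm m → Tm n
plug hole       s = s
plug (lamC C)   s = lam (plug C s)
plug (appL C t) s = app (plug C s) t
plug (appR t C) s = app t (plug C s)
plug (esL C t)  s = es (plug C s) t

-- how a variable of the outside scope is seen at the hole
ctxRen : ∀ {n m} → Ctx n m → Fin n → Fin m
ctxRen hole       = id
ctxRen (lamC C)   = ctxRen C ∘ suc
ctxRen (appL C t) = ctxRen C
ctxRen (appR t C) = ctxRen C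
ctxRen (esL C t)  = ctxRen C ∘ suc

compose : ∀ {n k m} → Ctx n k → Ctx k m → Ctx n m
compose hole       D = D
compose (lamC C)   D = lamC (compose C D)
compose (appL C t) D = appL (compose C D) t
compose (appR t C) D = appR t (compose C D)
compose (esL C t)  D = esL (compose C D) t

data SCtx : ℕ → ℕ → Set where
  shole : ∀ {n} → SCtx n n
  ssub  : ∀ {n m} → SCtx (suc n) m → Tm n → SCtx n m

plugS : ∀ {n m} → SCtx n m → Tm m → Tm n
plugS shole      s = s
plugS (ssub L t) s = es (plugS L s) t

sctxRen : ∀ {n m} → SCtx n m → Fin n → Fin m
sctxRen shole      = id
sctxRen (ssub L t) = sctxRen L ∘ suc

-- ls-step  D⟨C⟨x⟩[x←u]⟩ → D⟨C⟨u⟩[x←u]⟩ ; it duplicates u.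
data LsStep {n : ℕ} : Tm n → Tm n → Set where
  ls : ∀ {k m} (D : Ctx n k) (C : Ctx (suc k) m) (u : Tm k) →
       LsStep (plug D (es (plug C (var (ctxRen C zero))) u))
              (plug D (es (plug C (rename (ctxRen C ∘ suc) u)) u))

-- dB-step  D⟨(L⟨λx.t⟩) u⟩ → D⟨L⟨t[x←u]⟩⟩
data Step {n : ℕ} : Tm n → Tm n → Set where
  dB   : ∀ {k m} (D : Ctx n k) (L : SCtx k m) (t : Tm (suc m)) (u : Tm k) →
         Step (plug D (app (plugS L (lam t)) u))
              (plug D (plugS L (es t (rename (sctxRen L) u))))
  lsSt : ∀ {t t'} → LsStep t t' → Step t t'

dupScope : ∀ {n} {t t' : Tm n} → LsStep t t' → ℕ
dupScope (ls {k = k} D C u) = k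

duplicated : ∀ {n} {t t' : Tm n} (s : LsStep t t') → Tm (dupScope s)
duplicated (ls D C u) = u

holeScope : ∀ {n} {t t' : Tm n} → LsStep t t' → ℕ
holeScope (ls {m = m} D C u) = m

-- compact form  E⟨x⟩ → E⟨u⟩  with  E = D⟨C[x←u]⟩
compact : ∀ {n} {t t' : Tm n} (s : LsStep t t') → Ctx n (holeScope s)
compact (ls D C u) = compose D (esL C u)

data Steps {n : ℕ} : ℕ → Tm n → Tm n → Set where
  []  : ∀ {t} → Steps 0 t t
  _∷_ : ∀ {k t s r} → Step t s → Steps k s r → Steps (suc k) t r

data LsSteps {n : ℕ} : ℕ → Tm n → Tm n → Set where
  []  : ∀ {t} → LsSteps 0 t t
  _∷_ : ∀ {k t s r} → LsStep t s → LsSteps k s r → LsSteps (suc k) t r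

data _⊑_ : ∀ {m n} → Tm m → Tm n → Set where
  here  : ∀ {n} {t : Tm n} → t ⊑ t
  inLam : ∀ {m n} {s : Tm m} {t : Tm (suc n)} → s ⊑ t → s ⊑ lam t
  inAppL : ∀ {m n} {s : Tm m} {t u : Tm n} → s ⊑ t → s ⊑ app t u
  inAppR : ∀ {m n} {s : Tm m} {t u : Tm n} → s ⊑ u → s ⊑ app t u
  inEsL : ∀ {m n} {s : Tm m} {t : Tm (suc n)} {u : Tm n} → s ⊑ t → s ⊑ es t u
  inEsR : ∀ {m n} {s : Tm m} {t : Tm (suc n)} {u : Tm n} → s ⊑ u → s ⊑ es t u

-- u is a subterm of t (modulo α): u is an occurrence of a subterm of t
-- up to an injective renaming of its free variables.
SubtermOf : ∀ {k n} → Tm k → Tm n → Set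
SubtermOf {k} u t =
  Σ ℕ λ m → Σ (Tm m) λ s → Σ (Fin m → Fin k) λ ρ →
    s ⊑ t × Injective _≡_ _≡_ ρ × rename ρ s ≡ u

SubtermSteps : ∀ {n j} {t u : Tm n} → Tm n → Steps j t u → Set
SubtermSteps t₀ []             = ⊤
SubtermSteps t₀ (dB _ _ _ _ ∷ ρ) = SubtermSteps t₀ ρ
SubtermSteps t₀ (lsSt s ∷ ρ)   = SubtermOf (duplicated s) t₀ × SubtermSteps t₀ ρ

SubtermLsSteps : ∀ {n j} {t u : Tm n} → Tm n → LsSteps j t u → Set
SubtermLsSteps t₀ []      = ⊤
SubtermLsSteps t₀ (s ∷ ρ) = SubtermOf (duplicated s) t₀ × SubtermLsSteps t₀ ρ

-- Nestedness: consecutive ls-steps  C⟨x⟩ → C⟨D⟨y⟩⟩ → C⟨D⟨u'⟩⟩,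
-- i.e. the compact context of the second extends that of the first.

NestedPair : ∀ {n} {t s r : Tm n} → LsStep t s → LsStep s r → Set
NestedPair s₁ s₂ =
  Σ (Ctx (holeScope s₁) (holeScope s₂)) λ D → compact s₂ ≡ compose (compact s₁) D

Nested : ∀ {n j} {t r : Tm n} → LsSteps j t r → Set
Nested []                   = ⊤
Nested (s ∷ [])             = ⊤
Nested (s₁ ∷ (s₂ ∷ ρ))      = NestedPair s₁ s₂ × Nested (s₂ ∷ ρ)

-- An ls-step E⟨x⟩ → E⟨w⟩ substitutes a variable bound by an explicit substitution
-- sitting under some number d of other explicit substitutions; call d its depth.
-- The duplicated w is a subterm of the λ-term t, hence a λ-term, so in a nested
-- step E⟨D⟨y⟩⟩ → E⟨D⟨w'⟩⟩ the variable y, which is bound by an explicit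
-- substitution, is a free variable of the copy of w.  It is therefore bound above
-- [x←w], and the depth strictly decreases.  A nested sequence of k ls-steps thus
-- starts at depth at least k - 1, and a step of depth d needs d + 1 explicit
-- substitutions in its source u.  The prefix t →ⁿ u only matters through the
-- subterm property of the suffix.
module Submission where

open import Defs
open import Data.Nat using (ℕ; zero; suc; _+_; _≤_; _<_; z≤n; s≤s)
open import Data.Nat.Properties using (≤-refl; ≤-trans; m≤m+n; m≤n+m; m<m+n; +-identityʳ)
open import Data.Fin using (Fin; zero; suc)
open import Data.Product using (_,_)
open import Data.Unit using (⊤; tt)
open import Data.Empty using (⊥)
open import Function using (_∘′_)
open import Relation.Binary.PropositionalEquality
  using (_≡_; refl; sym; trans; cong; subst; module ≡-Reasoning)

plug-compose : ∀ {n k m} (A : Ctx n k) (B : Ctx k m) s →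
               plug (compose A B) s ≡ plug A (plug B s)
plug-compose hole       B s = refl
plug-compose (lamC A)   B s = cong lam (plug-compose A B s)
plug-compose (appL A t) B s = cong (λ a → app a t) (plug-compose A B s)
plug-compose (appR t A) B s = cong (app t) (plug-compose A B s)
plug-compose (esL A t)  B s = cong (λ a → es a t) (plug-compose A B s)

lam-injective : ∀ {n} {a b : Tm (suc n)} → lam a ≡ lam b → a ≡ b
lam-injective refl = refl

app-injectiveˡ : ∀ {n} {a b c d : Tm n} → app a c ≡ app b d → a ≡ b
app-injectiveˡ refl = refl

app-injectiveʳ : ∀ {n} {a b c d : Tm n} → app a c ≡ app b d → c ≡ d
app-injectiveʳ refl = refl

es-injectiveˡ : ∀ {n} {a b : Tm (suc n)} {c d : Tm n} → es a c ≡ es b d → a ≡ b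
es-injectiveˡ refl = refl

plug-injective : ∀ {n m} (A : Ctx n m) {s s'} → plug A s ≡ plug A s' → s ≡ s'
plug-injective hole       e = e
plug-injective (lamC A)   e = plug-injective A (lam-injective e)
plug-injective (appL A t) e = plug-injective A (app-injectiveˡ e)
plug-injective (appR t A) e = plug-injective A (app-injectiveʳ e)
plug-injective (esL A t)  e = plug-injective A (es-injectiveˡ e)

esDepth : ∀ {n m} → Ctx n m → ℕ
esDepth hole       = 0
esDepth (lamC C)   = esDepth C
esDepth (appL C t) = esDepth C
esDepth (appR t C) = esDepth C
esDepth (esL C t)  = suc (esDepth C)

esDepth+esCount≤esCount-plug : ∀ {n m} (D : Ctx n m) s →
                               esDepth D + esCount s ≤ esCount (plug D s)
esDepth+esCount≤esCount-plug hole       s = ≤-refl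
esDepth+esCount≤esCount-plug (lamC D)   s = esDepth+esCount≤esCount-plug D s
esDepth+esCount≤esCount-plug (appL D t) s = ≤-trans (esDepth+esCount≤esCount-plug D s) (m≤m+n _ _)
esDepth+esCount≤esCount-plug (appR t D) s = ≤-trans (esDepth+esCount≤esCount-plug D s) (m≤n+m _ _)
esDepth+esCount≤esCount-plug (esL D t)  s = s≤s (≤-trans (esDepth+esCount≤esCount-plug D s) (m≤m+n _ _))

IsLambda-rename : ∀ {n m} (σ : Fin n → Fin m) {w} → IsLambda w → IsLambda (rename σ w)
IsLambda-rename σ (var x)   = var (σ x)
IsLambda-rename σ (lam p)   = lam (IsLambda-rename (lift σ) p)
IsLambda-rename σ (app p q) = app (IsLambda-rename σ p) (IsLambda-rename σ q)

IsLambda-⊑ : ∀ {m n} {s : Tm m} {t : Tm n} → s ⊑ t → IsLambda t → IsLambda s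
IsLambda-⊑ here       p         = p
IsLambda-⊑ (inLam q)  (lam p)   = IsLambda-⊑ q p
IsLambda-⊑ (inAppL q) (app p _) = IsLambda-⊑ q p
IsLambda-⊑ (inAppR q) (app _ p) = IsLambda-⊑ q p

IsLambda-SubtermOf : ∀ {k n} {u : Tm k} {t : Tm n} → SubtermOf u t → IsLambda t → IsLambda u
IsLambda-SubtermOf (_ , _ , ρ , s⊑t , _ , ρs≡u) p =
  subst IsLambda ρs≡u (IsLambda-rename ρ (IsLambda-⊑ s⊑t p))

-- What binds a variable of the hole, seen from the root of a context.
-- byES d: an explicit substitution with d explicit substitutions above it.
data Binder (n : ℕ) : Set where
  free  : Fin n → Binder n
  byLam : Binder n
  byES  : ℕ → Binder n

throughLam : ∀ {n} → Binder (suc n) → Binder n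
throughLam (free zero)    = byLam
throughLam (free (suc x)) = free x
throughLam byLam          = byLam
throughLam (byES d)       = byES d

throughES : ∀ {n} → Binder (suc n) → Binder n
throughES (free zero)    = byES 0
throughES (free (suc x)) = free x
throughES byLam          = byLam
throughES (byES d)       = byES (suc d)

binderThrough : ∀ {n m} → Ctx n m → Binder m → Binder n
binderThrough hole       b = b
binderThrough (lamC C)   b = throughLam (binderThrough C b)
binderThrough (appL C t) b = binderThrough C b
binderThrough (appR t C) b = binderThrough C b
binderThrough (esL C t)  b = throughES (binderThrough C b)

binder : ∀ {n m} → Ctx n m → Fin m → Binder n
binder C y = binderThrough C (free y)

binderThrough-compose : ∀ {n k m} (A : Ctx n k) (B : Ctx k m) b →
                        binderThrough (compose A B) b ≡ binderThrough A (binderThrough B b)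
binderThrough-compose hole       B b = refl
binderThrough-compose (lamC A)   B b = cong throughLam (binderThrough-compose A B b)
binderThrough-compose (appL A t) B b = binderThrough-compose A B b
binderThrough-compose (appR t A) B b = binderThrough-compose A B b
binderThrough-compose (esL A t)  B b = cong throughES (binderThrough-compose A B b)

binderThrough-byLam : ∀ {n m} (A : Ctx n m) → binderThrough A byLam ≡ byLam
binderThrough-byLam hole       = refl
binderThrough-byLam (lamC A)   = cong throughLam (binderThrough-byLam A)
binderThrough-byLam (appL A t) = binderThrough-byLam A
binderThrough-byLam (appR t A) = binderThrough-byLam A
binderThrough-byLam (esL A t)  = cong throughES (binderThrough-byLam A)

binderThrough-byES : ∀ {n m} (A : Ctx n m) d → binderThrough A (byES d) ≡ byES (esDepth A + d)
binderThrough-byES hole       d = refl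
binderThrough-byES (lamC A)   d = cong throughLam (binderThrough-byES A d)
binderThrough-byES (appL A t) d = binderThrough-byES A d
binderThrough-byES (appR t A) d = binderThrough-byES A d
binderThrough-byES (esL A t)  d = cong throughES (binderThrough-byES A d)

binder-ctxRen : ∀ {n m} (C : Ctx n m) x → binder C (ctxRen C x) ≡ free x
binder-ctxRen hole       x = refl
binder-ctxRen (lamC C)   x = cong throughLam (binder-ctxRen C (suc x))
binder-ctxRen (appL C t) x = binder-ctxRen C x
binder-ctxRen (appR t C) x = binder-ctxRen C x
binder-ctxRen (esL C t)  x = cong throughES (binder-ctxRen C (suc x))

ShallowerThan : ∀ {n} → ℕ → Binder n → Set
ShallowerThan d b = ∀ {e} → b ≡ byES e → e < d

throughLam-shallower : ∀ {n d} {b : Binder (suc n)} →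
                       ShallowerThan d b → ShallowerThan d (throughLam b)
throughLam-shallower {b = free zero}    _ ()
throughLam-shallower {b = free (suc x)} _ ()
throughLam-shallower {b = byLam}        _ ()
throughLam-shallower {b = byES e}       h refl = h refl

throughES-shallower : ∀ {n d} {b : Binder (suc n)} →
                      ShallowerThan d b → ShallowerThan (suc d) (throughES b)
throughES-shallower {b = free zero}    _ refl = s≤s z≤n
throughES-shallower {b = free (suc x)} _ ()
throughES-shallower {b = byLam}        _ ()
throughES-shallower {b = byES e}       h refl = s≤s (h refl)

binder-shallower : ∀ {n m} (A : Ctx n m) x → ShallowerThan (esDepth A) (binder A x)
binder-shallower hole       x ()
binder-shallower (lamC A)   x = throughLam-shallower (binder-shallower A x)
binder-shallower (appL A t) x = binder-shallower A x
binder-shallower (appR t A) x = binder-shallower A x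
binder-shallower (esL A t)  x = throughES-shallower (binder-shallower A x)

liftPred : ∀ {n} → (Fin n → Set) → Fin (suc n) → Set
liftPred P zero    = ⊤
liftPred P (suc x) = P x

data LambdaOver {n : ℕ} (P : Fin n → Set) : Tm n → Set where
  var : ∀ {x} → P x → LambdaOver P (var x)
  lam : ∀ {t} → LambdaOver (liftPred P) t → LambdaOver P (lam t)
  app : ∀ {t u} → LambdaOver P t → LambdaOver P u → LambdaOver P (app t u)

rename-LambdaOver : ∀ {n m} {P : Fin m → Set} {σ : Fin n → Fin m} {w} →
                    IsLambda w → (∀ v → P (σ v)) → LambdaOver P (rename σ w)
rename-LambdaOver (var x)   Pσ = var (Pσ x)
rename-LambdaOver (lam p)   Pσ = lam (rename-LambdaOver p λ { zero → tt ; (suc v) → Pσ v })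
rename-LambdaOver (app p q) Pσ = app (rename-LambdaOver p Pσ) (rename-LambdaOver q Pσ)

BinderInLambda : ∀ {n} → (Fin n → Set) → Binder n → Set
BinderInLambda P (free x) = P x
BinderInLambda P byLam    = ⊤
BinderInLambda P (byES _) = ⊥

throughLam-BinderInLambda : ∀ {n} {P : Fin n → Set} b →
                            BinderInLambda (liftPred P) b → BinderInLambda P (throughLam b)
throughLam-BinderInLambda (free zero)    _ = tt
throughLam-BinderInLambda (free (suc x)) h = h
throughLam-BinderInLambda byLam          _ = tt

binder-LambdaOver : ∀ {n m} {P : Fin n → Set} (D : Ctx n m) {y} →
                    LambdaOver P (plug D (var y)) → BinderInLambda P (binder D y)
binder-LambdaOver hole       (var p)   = p
binder-LambdaOver (lamC D)   (lam p)   = throughLam-BinderInLambda (binder D _) (binder-LambdaOver D p)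
binder-LambdaOver (appL D t) (app p _) = binder-LambdaOver D p
binder-LambdaOver (appR t D) (app _ p) = binder-LambdaOver D p

binderThrough-shallower : ∀ {n m d} (E : Ctx n m) b →
                          BinderInLambda (λ z → ShallowerThan d (binder E z)) b →
                          ShallowerThan d (binderThrough E b)
binderThrough-shallower E (free z) h = h
binderThrough-shallower E byLam    _ e with () ← trans (sym (binderThrough-byLam E)) e
binderThrough-shallower E (byES _) ()

-- An ls-step st reads E⟨x⟩ → E⟨u⟩ with E = compact st = D⟨C[x←u]⟩.
lsDepth : ∀ {n} {t t' : Tm n} → LsStep t t' → ℕ
lsDepth (ls D C u) = esDepth D

lsVar : ∀ {n} {t t' : Tm n} (st : LsStep t t') → Fin (holeScope st)
lsVar (ls D C u) = ctxRen C zero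

copyRenaming : ∀ {n} {t t' : Tm n} (st : LsStep t t') → Fin (dupScope st) → Fin (holeScope st)
copyRenaming (ls D C u) v = ctxRen C (suc v)

ls-source : ∀ {n} {t t' : Tm n} (st : LsStep t t') → t ≡ plug (compact st) (var (lsVar st))
ls-source (ls D C u) = sym (plug-compose D (esL C u) _)

ls-target : ∀ {n} {t t' : Tm n} (st : LsStep t t') →
            t' ≡ plug (compact st) (rename (copyRenaming st) (duplicated st))
ls-target (ls D C u) = sym (plug-compose D (esL C u) _)

binder-lsVar : ∀ {n} {t t' : Tm n} (st : LsStep t t') →
               binder (compact st) (lsVar st) ≡ byES (lsDepth st)
binder-lsVar (ls D C u) = begin
  binderThrough (compose D (esL C u)) (free (ctxRen C zero))
    ≡⟨ binderThrough-compose D (esL C u) _ ⟩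
  binderThrough D (throughES (binder C (ctxRen C zero)))
    ≡⟨ cong (binderThrough D ∘′ throughES) (binder-ctxRen C zero) ⟩
  binderThrough D (byES 0)
    ≡⟨ binderThrough-byES D 0 ⟩
  byES (esDepth D + 0)
    ≡⟨ cong byES (+-identityʳ (esDepth D)) ⟩
  byES (esDepth D) ∎
  where open ≡-Reasoning

copy-binder-shallower : ∀ {n} {t t' : Tm n} (st : LsStep t t') v →
                        ShallowerThan (lsDepth st) (binder (compact st) (copyRenaming st v))
copy-binder-shallower (ls D C u) v rewrite binderThrough-compose D (esL C u) (free (ctxRen C (suc v)))
                                         | binder-ctxRen C (suc v) = binder-shallower D v

lsDepth<esCount : ∀ {n} {t t' : Tm n} (st : LsStep t t') → lsDepth st < esCount t
lsDepth<esCount (ls D C u) =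
  ≤-trans (m<m+n (esDepth D) (s≤s z≤n)) (esDepth+esCount≤esCount-plug D _)

nested-lsDepth-< : ∀ {n} {a b c : Tm n} (st₁ : LsStep a b) (st₂ : LsStep b c) →
                   IsLambda (duplicated st₁) → NestedPair st₁ st₂ → lsDepth st₂ < lsDepth st₁
nested-lsDepth-< st₁ st₂ λu (D , E₂≡E₁D) =
  binderThrough-shallower E₁ (binder D y) (binder-LambdaOver D occurrence) binder≡byES
  where
    E₁ = compact st₁
    y  = lsVar st₂
    copy = rename (copyRenaming st₁) (duplicated st₁)

    copy≡D⟨y⟩ : copy ≡ plug D (var y)
    copy≡D⟨y⟩ = plug-injective E₁ (begin
      plug E₁ copy                  ≡⟨ sym (ls-target st₁) ⟩
      _                             ≡⟨ ls-source st₂ ⟩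
      plug (compact st₂) (var y)    ≡⟨ cong (λ E → plug E (var y)) E₂≡E₁D ⟩
      plug (compose E₁ D) (var y)   ≡⟨ plug-compose E₁ D (var y) ⟩
      plug E₁ (plug D (var y))      ∎)
      where open ≡-Reasoning

    occurrence : LambdaOver (λ z → ShallowerThan (lsDepth st₁) (binder E₁ z)) (plug D (var y))
    occurrence = subst (LambdaOver _) copy≡D⟨y⟩
                   (rename-LambdaOver λu (copy-binder-shallower st₁))

    binder≡byES : binderThrough E₁ (binder D y) ≡ byES (lsDepth st₂)
    binder≡byES = begin
      binderThrough E₁ (binder D y)   ≡⟨ sym (binderThrough-compose E₁ D (free y)) ⟩
      binder (compose E₁ D) y         ≡⟨ cong (λ E → binder E y) (sym E₂≡E₁D) ⟩
      binder (compact st₂) y          ≡⟨ binder-lsVar st₂ ⟩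
      byES (lsDepth st₂)              ∎
      where open ≡-Reasoning

nested-length≤lsDepth : ∀ {n k} {t a b c : Tm n} → IsLambda t →
                        (st : LsStep a b) (ρ : LsSteps k b c) →
                        SubtermLsSteps t (st ∷ ρ) → Nested (st ∷ ρ) → k ≤ lsDepth st
nested-length≤lsDepth λt st []         _                 _              = z≤n
nested-length≤lsDepth λt st (st₂ ∷ ρ) (u⊑t , subterms) (nested , nesteds) =
  ≤-trans (s≤s (nested-length≤lsDepth λt st₂ ρ subterms nesteds))
          (nested-lsDepth-< st st₂ (IsLambda-SubtermOf u⊑t λt) nested)

mainTheorem10 : ∀ {N : ℕ} {n k : ℕ} (t u r : Tm N)
                  (ρ₁ : Steps n t u) (ρ₂ : LsSteps k u r) →
                  IsLambda t →
                  SubtermSteps t ρ₁ → SubtermLsSteps t ρ₂ →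
                  Nested ρ₂ →
                  k ≤ esCount u
mainTheorem10 t u r ρ₁ []       λt _ _         _      = z≤n
mainTheorem10 t u r ρ₁ (st ∷ ρ) λt _ subterms nested =
  ≤-trans (s≤s (nested-length≤lsDepth λt st ρ subterms nested)) (lsDepth<esCount st)
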